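{- Let $n\geq1$ and let $e=(e_1,\ldots,e_n)\in\mathbf{I}_n(\mathcal{AW})$ have parameters $(p,q)$. Then there are exactly $p+q$ sequences in $\mathbf{I}_{n+1}(\mathcal{AW})$ whose first $n$ entries are $e$; these are obtained by appending a last entry ranging from $0$ to $\max\{e_{n-1},e_n\}+1$, and in this order their parameters are $$(1,p),(2,p-1),\ldots,(p,1),\ (p+1,1),(p+2,1),\ldots,(p+q,1).$$
   Context: $\mathbf{I}_n=\{(e_1,\ldots,e_n): 0\leq e_i<i\}$ is the set of inversion sequences of length $n$. An inversion sequence is an $\mathcal{AW}$-inversion sequence if $e_i\leq\max\{e_{i-2},e_{i-1}\}+1$ for every $2<i\leq n$; $\mathbf{I}_n(\mathcal{AW})$ denotes the set of these. For $e\in\mathbf{I}_n(\mathcal{AW})$, its parameters are $(p,q)$ with $p=e_n+1$ and $q=\max\{e_{n-1},e_n\}+1-e_n$, where $e_0:=0$ by convention (relevant only for $n=1$). -}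

module Defs where

open import Data.Nat using (ℕ; zero; suc; _+_; _∸_; _≤_; _<_; _⊔_)
open import Data.Nat.Properties using (_<?_)
open import Data.Vec using (Vec; lookup)
open import Data.Fin using (fromℕ<)
open import Data.Product using (_×_)
open import Relation.Nullary using (yes; no)

-- 1-based entry access: ent e i = e_i for 1 ≤ i ≤ n, and 0 otherwise
-- (in particular ent e 0 = e_0 := 0, the paper's convention).
ent : ∀ {n} → Vec ℕ n → ℕ → ℕ
ent e zero = 0
ent {n} e (suc k) with k <? n
... | yes k<n = lookup e (fromℕ< k<n)
... | no _ = 0

IsInvSeq : (n : ℕ) → Vec ℕ n → Set
IsInvSeq n e = ∀ i → 1 ≤ i → i ≤ n → ent e i < i

IsAW : (n : ℕ) → Vec ℕ n → Set
IsAW n e = IsInvSeq n e ×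
  (∀ i → 2 < i → i ≤ n → ent e i ≤ (ent e (i ∸ 2) ⊔ ent e (i ∸ 1)) + 1)

pPar : ∀ {n} → Vec ℕ n → ℕ
pPar {n} e = ent e n + 1

qPar : ∀ {n} → Vec ℕ n → ℕ
qPar {n} e = (ent e (n ∸ 1) ⊔ ent e n) + 1 ∸ ent e n

-- Appending x to e only adds the index n + 1, so e ∷ʳ x is an AW-inversion
-- sequence iff x ≤ max{e_{n-1}, e_n} + 1 (the bound x ≤ n of I_{n+1} is implied,
-- as both e_{n-1} ≤ n - 2 and e_n ≤ n - 1). The new parameters are
-- p' = x + 1 and q' = max{e_n, x} + 1 - x, which is p - x for x < p and 1 otherwise.
module Submission where

open import Defs
open import Data.Nat using (ℕ; zero; suc; _+_; _∸_; _≤_; _<_; _⊔_; z≤n; s≤s; s≤s⁻¹)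
open import Data.Nat.Properties
open import Data.Vec using (Vec; []; _∷_; _∷ʳ_; lookup)
open import Data.Fin using (fromℕ<)
open import Data.Product using (_×_; _,_; proj₂)
open import Data.Sum using (inj₁; inj₂)
open import Function.Base using (id)
open import Function.Bundles using (_⇔_; mk⇔; Equivalence)
open import Relation.Binary.PropositionalEquality
open import Relation.Nullary using (yes; no)
open import Data.Empty using (⊥-elim)

private
  variable
    n : ℕ

ent-suc : (e : Vec ℕ n) {k : ℕ} (k<n : k < n) → ent e (suc k) ≡ lookup e (fromℕ< k<n)
ent-suc {n} e {k} k<n with k <? n
... | yes _  = refl
... | no k≮n = ⊥-elim (k≮n k<n)

lookup-∷ʳ-fromℕ< : (e : Vec ℕ n) (x : ℕ) {k : ℕ} (k<1+n : k < suc n) (k<n : k < n) →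
  lookup (e ∷ʳ x) (fromℕ< k<1+n) ≡ lookup e (fromℕ< k<n)
lookup-∷ʳ-fromℕ< (y ∷ e) x {zero}  _           _         = refl
lookup-∷ʳ-fromℕ< (y ∷ e) x {suc k} (s≤s k<1+n) (s≤s k<n) = lookup-∷ʳ-fromℕ< e x k<1+n k<n

lookup-∷ʳ-last : (e : Vec ℕ n) (x : ℕ) (n<1+n : n < suc n) → lookup (e ∷ʳ x) (fromℕ< n<1+n) ≡ x
lookup-∷ʳ-last []      x _             = refl
lookup-∷ʳ-last (y ∷ e) x (s≤s n<1+n) = lookup-∷ʳ-last e x n<1+n

ent-∷ʳ : (e : Vec ℕ n) (x : ℕ) {i : ℕ} → i ≤ n → ent (e ∷ʳ x) i ≡ ent e i
ent-∷ʳ e x {zero}  _   = refl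
ent-∷ʳ e x {suc k} k<n = begin
  ent (e ∷ʳ x) (suc k)                      ≡⟨ ent-suc (e ∷ʳ x) (m≤n⇒m≤1+n k<n) ⟩
  lookup (e ∷ʳ x) (fromℕ< (m≤n⇒m≤1+n k<n)) ≡⟨ lookup-∷ʳ-fromℕ< e x (m≤n⇒m≤1+n k<n) k<n ⟩
  lookup e (fromℕ< k<n)                     ≡⟨ ent-suc e k<n ⟨
  ent e (suc k)                             ∎
  where open ≡-Reasoning

ent-∷ʳ-last : (e : Vec ℕ n) (x : ℕ) → ent (e ∷ʳ x) (suc n) ≡ x
ent-∷ʳ-last e x = trans (ent-suc (e ∷ʳ x) ≤-refl) (lookup-∷ʳ-last e x ≤-refl)

ent≤pred : {e : Vec ℕ n} → IsInvSeq n e → {i : ℕ} → i ≤ n → ent e i ≤ i ∸ 1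
ent≤pred inv {zero}  _   = z≤n
ent≤pred inv {suc k} i≤n = s≤s⁻¹ (inv (suc k) (s≤s z≤n) i≤n)

lastMax : Vec ℕ n → ℕ
lastMax {n} e = ent e (n ∸ 1) ⊔ ent e n

lastMax<n : 1 ≤ n → {e : Vec ℕ n} → IsInvSeq n e → lastMax e + 1 ≤ n
lastMax<n {suc m} _ {e} inv = begin
  lastMax e + 1   ≡⟨ +-comm (lastMax e) 1 ⟩
  suc (lastMax e) ≤⟨ s≤s (⊔-lub (≤-trans (ent≤pred inv (n≤1+n m)) (m∸n≤m m 1))
                                (ent≤pred inv ≤-refl)) ⟩
  suc m           ∎
  where open ≤-Reasoning

IsInvSeq-∷ʳ⇔ : (e : Vec ℕ n) (x : ℕ) → IsInvSeq (suc n) (e ∷ʳ x) ⇔ (IsInvSeq n e × x ≤ n)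
IsInvSeq-∷ʳ⇔ {n} e x = mk⇔ restrict extend
  where
  restrict : IsInvSeq (suc n) (e ∷ʳ x) → IsInvSeq n e × x ≤ n
  restrict inv =
    (λ i 1≤i i≤n → subst (_< i) (ent-∷ʳ e x i≤n) (inv i 1≤i (m≤n⇒m≤1+n i≤n))) ,
    s≤s⁻¹ (subst (_< suc n) (ent-∷ʳ-last e x) (inv (suc n) (s≤s z≤n) ≤-refl))
  extend : IsInvSeq n e × x ≤ n → IsInvSeq (suc n) (e ∷ʳ x)
  extend (inv , x≤n) i 1≤i i≤1+n with m≤n⇒m<n∨m≡n i≤1+n
  ... | inj₁ i<1+n = subst (_< i) (sym (ent-∷ʳ e x (s≤s⁻¹ i<1+n))) (inv i 1≤i (s≤s⁻¹ i<1+n))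
  ... | inj₂ refl  = subst (_< suc n) (sym (ent-∷ʳ-last e x)) (s≤s x≤n)

AWAt : Vec ℕ n → ℕ → Set
AWAt e i = ent e i ≤ (ent e (i ∸ 2) ⊔ ent e (i ∸ 1)) + 1

AWAt-∷ʳ : (e : Vec ℕ n) (x : ℕ) {i : ℕ} → i ≤ n → AWAt (e ∷ʳ x) i ≡ AWAt e i
AWAt-∷ʳ e x {i} i≤n =
  cong₂ _≤_ (ent-∷ʳ e x i≤n)
    (cong (_+ 1) (cong₂ _⊔_ (ent-∷ʳ e x (≤-trans (m∸n≤m i 2) i≤n))
                            (ent-∷ʳ e x (≤-trans (m∸n≤m i 1) i≤n))))

AWAt-∷ʳ-last : (e : Vec ℕ n) (x : ℕ) → AWAt (e ∷ʳ x) (suc n) ≡ (x ≤ lastMax e + 1)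
AWAt-∷ʳ-last {n} e x =
  cong₂ _≤_ (ent-∷ʳ-last e x)
    (cong (_+ 1) (cong₂ _⊔_ (ent-∷ʳ e x (m∸n≤m n 1)) (ent-∷ʳ e x ≤-refl)))

IsAW-∷ʳ⇔ : 1 ≤ n → (e : Vec ℕ n) → IsAW n e → (x : ℕ) →
  IsAW (suc n) (e ∷ʳ x) ⇔ x ≤ lastMax e + 1
IsAW-∷ʳ⇔ {n} 1≤n e (inv , aw) x = mk⇔ bound extend
  where
  bound : IsAW (suc n) (e ∷ʳ x) → x ≤ lastMax e + 1
  bound (inv′ , aw′) with 2 <? suc n
  ... | yes 2<1+n = subst id (AWAt-∷ʳ-last e x) (aw′ (suc n) 2<1+n ≤-refl)
  ... | no 2≮1+n  = ≤-trans (proj₂ (Equivalence.to (IsInvSeq-∷ʳ⇔ e x) inv′))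
                            (≤-trans (s≤s⁻¹ (≮⇒≥ 2≮1+n)) (m≤n+m 1 (lastMax e)))
  extend : x ≤ lastMax e + 1 → IsAW (suc n) (e ∷ʳ x)
  extend x≤ = Equivalence.from (IsInvSeq-∷ʳ⇔ e x) (inv , ≤-trans x≤ (lastMax<n 1≤n inv)) , aw′
    where
    aw′ : ∀ i → 2 < i → i ≤ suc n → AWAt (e ∷ʳ x) i
    aw′ i 2<i i≤1+n with m≤n⇒m<n∨m≡n i≤1+n
    ... | inj₁ i<1+n = subst id (sym (AWAt-∷ʳ e x (s≤s⁻¹ i<1+n))) (aw i 2<i (s≤s⁻¹ i<1+n))
    ... | inj₂ refl  = subst id (sym (AWAt-∷ʳ-last e x)) x≤

pPar+qPar : (e : Vec ℕ n) → pPar e + qPar e ≡ lastMax e + 2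
pPar+qPar {n} e = begin
  b + 1 + (M + 1 ∸ b)   ≡⟨ cong (_+ (M + 1 ∸ b)) (+-comm b 1) ⟩
  suc (b + (M + 1 ∸ b)) ≡⟨ cong suc (m+[n∸m]≡n (≤-trans (m≤n⊔m (ent e (n ∸ 1)) b) (m≤m+n M 1))) ⟩
  suc (M + 1)           ≡⟨ +-suc M 1 ⟨
  M + 2                 ∎
  where
  open ≡-Reasoning
  b = ent e n
  M = lastMax e

pPar-∷ʳ : (e : Vec ℕ n) (x : ℕ) → pPar (e ∷ʳ x) ≡ x + 1
pPar-∷ʳ e x = cong (_+ 1) (ent-∷ʳ-last e x)

qPar-∷ʳ : (e : Vec ℕ n) (x : ℕ) → qPar (e ∷ʳ x) ≡ (ent e n ⊔ x) + 1 ∸ x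
qPar-∷ʳ {n} e x rewrite ent-∷ʳ e x {n} ≤-refl | ent-∷ʳ-last e x = refl

qPar-∷ʳ-below : (e : Vec ℕ n) (x : ℕ) → x < pPar e → qPar (e ∷ʳ x) ≡ pPar e ∸ x
qPar-∷ʳ-below {n} e x x<p = trans (qPar-∷ʳ e x)
  (cong (λ m → m + 1 ∸ x) (m≥n⇒m⊔n≡m (s≤s⁻¹ (subst (x <_) (+-comm (ent e n) 1) x<p))))

qPar-∷ʳ-above : (e : Vec ℕ n) (x : ℕ) → pPar e ≤ x → qPar (e ∷ʳ x) ≡ 1
qPar-∷ʳ-above {n} e x p≤x = begin
  qPar (e ∷ʳ x)        ≡⟨ qPar-∷ʳ e x ⟩
  (ent e n ⊔ x) + 1 ∸ x ≡⟨ cong (λ m → m + 1 ∸ x) (m≤n⇒m⊔n≡n (≤-trans (m≤m+n (ent e n) 1) p≤x)) ⟩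
  x + 1 ∸ x            ≡⟨ m+n∸m≡n x 1 ⟩
  1                    ∎
  where open ≡-Reasoning

lemma5p1 : (n : ℕ) → 1 ≤ n → (e : Vec ℕ n) → IsAW n e →
    (pPar e + qPar e ≡ (ent e (n ∸ 1) ⊔ ent e n) + 2)
    × (∀ (x : ℕ) → (IsAW (suc n) (e ∷ʳ x) ⇔ x ≤ (ent e (n ∸ 1) ⊔ ent e n) + 1))
    × (∀ (x : ℕ) → x < pPar e →
        (pPar (e ∷ʳ x) ≡ x + 1) × (qPar (e ∷ʳ x) ≡ pPar e ∸ x))
    × (∀ (x : ℕ) → pPar e ≤ x → x < pPar e + qPar e →
        (pPar (e ∷ʳ x) ≡ x + 1) × (qPar (e ∷ʳ x) ≡ 1))
lemma5p1 n 1≤n e isAW =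
  pPar+qPar e ,
  IsAW-∷ʳ⇔ 1≤n e isAW ,
  (λ x x<p → pPar-∷ʳ e x , qPar-∷ʳ-below e x x<p) ,
  (λ x p≤x _ → pPar-∷ʳ e x , qPar-∷ʳ-above e x p≤x)
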